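{- For an integer $n\geq 9$, Left will win the path position $P_n$ in the Mutual Failures Variant regardless of which player moves first.
   Context: The Mutual Failures Variant of the Mixed Deletion Game is a partisan combinatorial game played on a finite simple undirected graph by two players, Left and Right, who alternate turns. On her turn Left deletes one vertex together with all its incident edges; on his turn Right deletes one edge. A deletion that would create an isolated vertex ends the game and the player who made it loses (so such deletions are effectively unavailable). In addition, the Mutual Failures Variant imposes the condition that in any graph position Right has no available move if and only if Left has no available move. $P_n$ denotes the game position on the path graph with $n$ vertices. -}

module Defs where

open import Data.Nat using (ℕ; zero; suc; _≡ᵇ_)
open import Data.Fin using (Fin; toℕ; punchIn; _≟_) renaming (_<_ to _<ᶠ_)
open import Data.Bool using (Bool; true; false; _∨_; _∧_; if_then_else_)
open import Data.Product using (Σ; Σ-syntax; _×_)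
open import Data.Empty using (⊥)
open import Relation.Nullary.Decidable using (⌊_⌋)
open import Relation.Binary.PropositionalEquality using (_≡_)

-- All graphs arising in this development
-- (paths and positions reached from them) are symmetric and irreflexive.
Graph : ℕ → Set
Graph n = Fin n → Fin n → Bool

path : (n : ℕ) → Graph n
path n i j = (suc (toℕ i) ≡ᵇ toℕ j) ∨ (suc (toℕ j) ≡ᵇ toℕ i)

NoIsolated : ∀ {n} → Graph n → Set
NoIsolated {n} G = (v : Fin n) → Σ[ w ∈ Fin n ] (G v w ≡ true)

-- Left's move: delete vertex v together with its incident edges.
delV : ∀ {m} → Graph (suc m) → Fin (suc m) → Graph m
delV G v i j = G (punchIn v i) (punchIn v j)

-- Right's move: delete the edge {i , j}.
delE : ∀ {n} → Graph n → Fin n → Fin n → Graph n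
delE G i j a b =
  if (⌊ a ≟ i ⌋ ∧ ⌊ b ≟ j ⌋) ∨ (⌊ a ≟ j ⌋ ∧ ⌊ b ≟ i ⌋) then false else G a b

LegalL : ∀ {m} → Graph (suc m) → Fin (suc m) → Set
LegalL G v = NoIsolated (delV G v)

LegalR : ∀ {n} → Graph n → Fin n → Fin n → Set
LegalR G i j = (i <ᶠ j) × (G i j ≡ true) × NoIsolated (delE G i j)

HasLegalL : ∀ {n} → Graph n → Set
HasLegalL {zero} G = ⊥
HasLegalL {suc m} G = Σ[ v ∈ Fin (suc m) ] LegalL G v

HasLegalR : ∀ {n} → Graph n → Set
HasLegalR {n} G = Σ[ i ∈ Fin n ] Σ[ j ∈ Fin n ] LegalR G i j

-- Mutual Failures Variant: a player's legal move is available only if the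
-- opponent also has a legal move (so Right has no available move iff Left
-- has none).  A player with no available move loses (normal play).
--
-- LeftWinsL G : Left, moving first in G, has a winning strategy.
-- LeftWinsR G : Right moves first in G, and Left has a winning strategy.
data LeftWinsL : {n : ℕ} → Graph n → Set
data LeftWinsR : {n : ℕ} → Graph n → Set

data LeftWinsL where
  move : ∀ {m} {G : Graph (suc m)} (v : Fin (suc m)) →
         LegalL G v → HasLegalR G → LeftWinsR (delV G v) → LeftWinsL G

data LeftWinsR where
  respond : ∀ {n} {G : Graph n} →
            (HasLegalL G → (i j : Fin n) → LegalR G i j →
               LeftWinsL (delE G i j)) →
            LeftWinsR G

-- Every position reached from P_n is a disjoint union of paths, recorded as the list of their numbers of
-- vertices; no path has exactly one vertex, since that vertex would be isolated. Left keeps the following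
-- invariant for positions with Right to move: the number of paths on 4 vertices and the number of paths on
-- 5, 6 or 8 vertices have the same parity, and if the former is odd some path has 5 or 8 vertices. Whatever
-- path Right splits into two pieces of at least 2 vertices, Left restores the invariant by shortening or
-- cutting a path on 4, 5, 6 or 8 vertices (to 3, 7, 2+3, 2+2, or to 2+5, 5, 4); if no such move is called
-- for, one of Right's two pieces has 3, 7 or at least 9 vertices and can be cut into 0+2, 3+3, 4+4 or
-- 0+(k-1) without affecting the invariant. Before each of Left's moves some path has at least 4 vertices,
-- so Right can still move, as the Mutual Failures rule requires. For n ≥ 9, P_n satisfies the invariant,
-- and Left's first move is such a neutral cut. The case analysis behind Left's replies depends only on a
-- five-bit summary of the position and is verified by exhaustion.

module Submission where

open import Defs
open import Data.Bool using (Bool; true; false; T; not; _∧_; _∨_; _xor_; if_then_else_)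
open import Data.Bool.Properties using (T-∧; T-∨; ∧-zeroʳ; ∨-zeroʳ; xor-assoc; xor-comm; ∨-assoc; ∨-comm)
open import Data.Empty using (⊥-elim)
open import Data.Fin using (Fin; toℕ; fromℕ<; punchIn; _≟_) renaming (zero to fzero; suc to fsuc)
open import Data.Fin.Properties using (toℕ<n; toℕ-fromℕ<; toℕ-injective)
open import Data.List using (List; []; _∷_; _++_; [_])
open import Data.List.Properties using (++-assoc)
open import Data.List.Membership.Propositional using (_∈_; find)
open import Data.List.Membership.Propositional.Properties using (∈-∃++)
open import Data.List.Relation.Unary.All using (All; []; _∷_; tabulate)
open import Data.List.Relation.Unary.All.Properties using (++⁺; ++⁻; ++⁻ʳ)
open import Data.List.Relation.Unary.Any using (Any; here; there)
open import Data.List.Relation.Unary.Any.Properties using (++⁺ʳ)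
open import Data.Nat using (ℕ; zero; suc; _+_; _∸_; _<_; _≤_; _≡ᵇ_; _<ᵇ_; _≤ᵇ_; z≤n; s≤s; _≤?_)
open import Data.Nat.ListAction using (sum)
open import Data.Nat.ListAction.Properties using (sum-++)
open import Data.Nat.Properties
  using (≡ᵇ⇒≡; ≡⇒≡ᵇ; <ᵇ⇒<; ≤ᵇ⇒≤; ≤⇒≤ᵇ; suc-injective; +-suc; +-assoc; +-identityʳ; m+[n∸m]≡n; m≤m+n;
         +-monoʳ-<; <-asym; <-trans; n<1+n; ≰⇒>; ≤-trans; <⇒≤; m<n⇒0<n∸m; m<1+n⇒m<n∨m≡n; m≤n⇒∃[o]m+o≡n)
open import Data.Product using (Σ-syntax; _×_; _,_; proj₁; proj₂)
open import Data.Sum using (_⊎_; inj₁; inj₂; map₁)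
open import Function using (_∘_; case_of_)
open import Function.Bundles using (Equivalence)
open import Relation.Nullary using (¬_; yes; no)
open import Relation.Nullary.Decidable using (⌊_⌋)
open import Relation.Binary.PropositionalEquality
  using (_≡_; _≢_; _≗_; refl; sym; trans; cong; cong₂; subst; module ≡-Reasoning)

infix 4 _≈ᴳ_

_≈ᴳ_ : ∀ {n} → Graph n → Graph n → Set
G ≈ᴳ H = ∀ a b → G a b ≡ H a b

≈ᴳ-sym : ∀ {n} {G H : Graph n} → G ≈ᴳ H → H ≈ᴳ G
≈ᴳ-sym G≈H a b = sym (G≈H a b)

≈ᴳ-trans : ∀ {n} {G H K : Graph n} → G ≈ᴳ H → H ≈ᴳ K → G ≈ᴳ K
≈ᴳ-trans G≈H H≈K a b = trans (G≈H a b) (H≈K a b)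

noIsolated-resp : ∀ {n} {G H : Graph n} → G ≈ᴳ H → NoIsolated G → NoIsolated H
noIsolated-resp G≈H noIso v with noIso v
... | w , Gvw = w , trans (sym (G≈H v w)) Gvw

delV-resp : ∀ {m} {G H : Graph (suc m)} v → G ≈ᴳ H → delV G v ≈ᴳ delV H v
delV-resp v G≈H a b = G≈H _ _

delE-resp : ∀ {n} {G H : Graph n} i j → G ≈ᴳ H → delE G i j ≈ᴳ delE H i j
delE-resp i j G≈H a b =
  cong (if (⌊ a ≟ i ⌋ ∧ ⌊ b ≟ j ⌋) ∨ (⌊ a ≟ j ⌋ ∧ ⌊ b ≟ i ⌋) then false else_) (G≈H a b)

legalR-resp : ∀ {n} {G H : Graph n} {i j} → G ≈ᴳ H → LegalR G i j → LegalR H i j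
legalR-resp {i = i} {j} G≈H (i<j , Gij , noIso) =
  i<j , trans (sym (G≈H i j)) Gij , noIsolated-resp (delE-resp i j G≈H) noIso

hasLegalR-resp : ∀ {n} {G H : Graph n} → G ≈ᴳ H → HasLegalR G → HasLegalR H
hasLegalR-resp G≈H (i , j , legal) = i , j , legalR-resp G≈H legal

hasLegalL-resp : ∀ {n} {G H : Graph n} → G ≈ᴳ H → HasLegalL G → HasLegalL H
hasLegalL-resp {suc m} G≈H (v , legal) = v , noIsolated-resp (delV-resp v G≈H) legal

leftWinsL-resp : ∀ {n} {G H : Graph n} → G ≈ᴳ H → LeftWinsL G → LeftWinsL H
leftWinsR-resp : ∀ {n} {G H : Graph n} → G ≈ᴳ H → LeftWinsR G → LeftWinsR H

leftWinsL-resp G≈H (move v legal rightCanMove win) =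
  move v (noIsolated-resp (delV-resp v G≈H) legal) (hasLegalR-resp G≈H rightCanMove)
    (leftWinsR-resp (delV-resp v G≈H) win)
leftWinsR-resp G≈H (respond win) =
  respond λ leftCanMove i j legal → leftWinsL-resp (delE-resp i j G≈H)
    (win (hasLegalL-resp (≈ᴳ-sym G≈H) leftCanMove) i j (legalR-resp (≈ᴳ-sym G≈H) legal))

-- Linear graphs

-- An edge indicator on the vertices 0, 1, 2, …: `e k` says whether k and k + 1 are adjacent.
Edges : Set
Edges = ℕ → Bool

adjacent : Edges → ℕ → ℕ → Bool
adjacent e a b = ((suc a ≡ᵇ b) ∧ e a) ∨ ((suc b ≡ᵇ a) ∧ e b)

linear : (n : ℕ) → Edges → Graph n
linear n e i j = adjacent e (toℕ i) (toℕ j)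

linear-cong : ∀ n {e e′ : Edges} → e ≗ e′ → linear n e ≈ᴳ linear n e′
linear-cong n e≗e′ a b = cong₂ (λ x y → ((suc (toℕ a) ≡ᵇ toℕ b) ∧ x) ∨ ((suc (toℕ b) ≡ᵇ toℕ a) ∧ y))
  (e≗e′ (toℕ a)) (e≗e′ (toℕ b))

≡ᵇ-refl : ∀ n → (n ≡ᵇ n) ≡ true
≡ᵇ-refl zero    = refl
≡ᵇ-refl (suc n) = ≡ᵇ-refl n

adjacent-suc : ∀ e k → e k ≡ true → adjacent e k (suc k) ≡ true
adjacent-suc e k ek rewrite ≡ᵇ-refl k | ek = refl

adjacent-pred : ∀ e k → e k ≡ true → adjacent e (suc k) k ≡ true
adjacent-pred e k ek rewrite ≡ᵇ-refl k | ek = ∨-zeroʳ _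

adjacent-forward : ∀ e a b → a < b → adjacent e a b ≡ true → b ≡ suc a × e a ≡ true
adjacent-forward e a b a<b adj with suc a ≡ᵇ b in 1+a≡b | e a | suc b ≡ᵇ a in 1+b≡a
... | true  | true  | _     = sym (≡ᵇ⇒≡ _ _ (subst T (sym 1+a≡b) _)) , refl
... | _     | _     | true  = ⊥-elim (<-asym a<b (subst (b <_) (≡ᵇ⇒≡ _ _ (subst T (sym 1+b≡a) _)) (n<1+n b)))
... | true  | false | false = ⊥-elim (case adj of λ ())
... | false | _     | false = ⊥-elim (case adj of λ ())

-- The edges left after deleting vertex v; the vertices above v are renumbered down by one.
deleteVertex : ℕ → Edges → Edges
deleteVertex zero    e k       = e (suc k)
deleteVertex (suc v) e zero    = (0 <ᵇ v) ∧ e zero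
deleteVertex (suc v) e (suc k) = deleteVertex v (e ∘ suc) k

deleteEdge : ℕ → Edges → Edges
deleteEdge i e k = not (k ≡ᵇ i) ∧ e k

punchInℕ : ℕ → ℕ → ℕ
punchInℕ zero    a       = suc a
punchInℕ (suc v) zero    = zero
punchInℕ (suc v) (suc a) = suc (punchInℕ v a)

toℕ-punchIn : ∀ {m} (v : Fin (suc m)) (a : Fin m) → toℕ (punchIn v a) ≡ punchInℕ (toℕ v) (toℕ a)
toℕ-punchIn fzero    a        = refl
toℕ-punchIn (fsuc v) fzero    = refl
toℕ-punchIn (fsuc v) (fsuc a) = cong suc (toℕ-punchIn v a)

adjacent-punchIn : ∀ v e a b →
  adjacent e (punchInℕ v a) (punchInℕ v b) ≡ adjacent (deleteVertex v e) a b
adjacent-punchIn zero          e a             b             = refl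
adjacent-punchIn (suc v)       e zero          zero          = refl
adjacent-punchIn (suc zero)    e zero          (suc zero)    = refl
adjacent-punchIn (suc zero)    e zero          (suc (suc b)) = refl
adjacent-punchIn (suc (suc v)) e zero          (suc zero)    = refl
adjacent-punchIn (suc (suc v)) e zero          (suc (suc b)) = refl
adjacent-punchIn (suc zero)    e (suc zero)    zero          = refl
adjacent-punchIn (suc zero)    e (suc (suc a)) zero          = refl
adjacent-punchIn (suc (suc v)) e (suc zero)    zero          = refl
adjacent-punchIn (suc (suc v)) e (suc (suc a)) zero          = refl
adjacent-punchIn (suc v)       e (suc a)       (suc b)       = adjacent-punchIn v (e ∘ suc) a b

delV-linear : ∀ m e (v : Fin (suc m)) → delV (linear (suc m) e) v ≈ᴳ linear m (deleteVertex (toℕ v) e)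
delV-linear m e v a b =
  trans (cong₂ (adjacent e) (toℕ-punchIn v a) (toℕ-punchIn v b)) (adjacent-punchIn (toℕ v) e (toℕ a) (toℕ b))

joins : ℕ → ℕ → ℕ → Bool
joins i a b = ((a ≡ᵇ i) ∧ (b ≡ᵇ suc i)) ∨ ((a ≡ᵇ suc i) ∧ (b ≡ᵇ i))

adjacent-deleteEdge : ∀ i e a b →
  adjacent (deleteEdge i e) a b ≡ (if joins i a b then false else adjacent e a b)
adjacent-deleteEdge zero    e zero          zero          = refl
adjacent-deleteEdge zero    e zero          (suc zero)    = refl
adjacent-deleteEdge zero    e zero          (suc (suc b)) = refl
adjacent-deleteEdge zero    e (suc zero)    zero          = refl
adjacent-deleteEdge zero    e (suc (suc a)) zero          = refl
adjacent-deleteEdge zero    e (suc zero)    (suc b)       = refl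
adjacent-deleteEdge zero    e (suc (suc a)) (suc b)       = refl
adjacent-deleteEdge (suc i) e zero          zero          = refl
adjacent-deleteEdge (suc i) e zero          (suc b)       = refl
adjacent-deleteEdge (suc i) e (suc a)       zero
  rewrite ∧-zeroʳ (a ≡ᵇ i) | ∧-zeroʳ (a ≡ᵇ suc i) = refl
adjacent-deleteEdge (suc i) e (suc a)       (suc b)       = adjacent-deleteEdge i (e ∘ suc) a b

⌊≟⌋≡≡ᵇ : ∀ {n} (a b : Fin n) → ⌊ a ≟ b ⌋ ≡ (toℕ a ≡ᵇ toℕ b)
⌊≟⌋≡≡ᵇ a b with a ≟ b
... | yes refl = sym (≡ᵇ-refl (toℕ a))
... | no a≢b with toℕ a ≡ᵇ toℕ b in a≡ᵇb
...   | false = refl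
...   | true  = ⊥-elim (a≢b (toℕ-injective (≡ᵇ⇒≡ _ _ (subst T (sym a≡ᵇb) _))))

delE-linear : ∀ n e (i j : Fin n) → toℕ j ≡ suc (toℕ i) →
  delE (linear n e) i j ≈ᴳ linear n (deleteEdge (toℕ i) e)
delE-linear n e i j j≡1+i a b =
  trans (cong (if_then false else adjacent e (toℕ a) (toℕ b)) endpoints)
        (sym (adjacent-deleteEdge (toℕ i) e (toℕ a) (toℕ b)))
  where
  endpoints : (⌊ a ≟ i ⌋ ∧ ⌊ b ≟ j ⌋) ∨ (⌊ a ≟ j ⌋ ∧ ⌊ b ≟ i ⌋) ≡ joins (toℕ i) (toℕ a) (toℕ b)
  endpoints rewrite ⌊≟⌋≡≡ᵇ a i | ⌊≟⌋≡≡ᵇ b j | ⌊≟⌋≡≡ᵇ a j | ⌊≟⌋≡≡ᵇ b i | j≡1+i = refl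

-- Disjoint unions of paths

-- The edges of the disjoint union of paths whose numbers of vertices are listed, laid out consecutively.
segmentEdges : List ℕ → Edges
segmentEdges []          k       = false
segmentEdges (zero ∷ L)  k       = segmentEdges L k
segmentEdges (suc s ∷ L) zero    = 0 <ᵇ s
segmentEdges (suc s ∷ L) (suc k) = segmentEdges (s ∷ L) k

paths : (n : ℕ) → List ℕ → Graph n
paths n L = linear n (segmentEdges L)

NoSingleton : List ℕ → Set
NoSingleton = All (_≢ 1)

-- What is left of a path on y vertices after deleting its vertex q.
pieces : ℕ → ℕ → List ℕ
pieces y q = q ∷ (y ∸ suc q) ∷ []

noSingleton-middle : ∀ A {x} B → NoSingleton (A ++ x ∷ B) → x ≢ 1
noSingleton-middle A B noSingleton with ++⁻ʳ A noSingleton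
... | x≢1 ∷ _ = x≢1

noSingleton-replace : ∀ A {x} B {M} → NoSingleton (A ++ x ∷ B) → NoSingleton M → NoSingleton (A ++ M ++ B)
noSingleton-replace A B noSingleton noSingletonM with ++⁻ A noSingleton
... | noSingletonA , _ ∷ noSingletonB = ++⁺ noSingletonA (++⁺ noSingletonM noSingletonB)

sum-middle-< : ∀ A {x} B {q} → q < x → sum A + q < sum (A ++ x ∷ B)
sum-middle-< A {x} B q<x rewrite sum-++ A (x ∷ B) = +-monoʳ-< (sum A) (≤-trans q<x (m≤m+n x (sum B)))

sum-replace : ∀ A B {M M′} → sum M ≡ sum M′ → sum (A ++ M ++ B) ≡ sum (A ++ M′ ++ B)
sum-replace A B {M} {M′} eq rewrite sum-++ A (M ++ B) | sum-++ A (M′ ++ B) | sum-++ M B | sum-++ M′ B | eq = refl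

segmentEdges-shift : ∀ a L k → segmentEdges (a ∷ L) (a + k) ≡ segmentEdges L k
segmentEdges-shift zero    L k = refl
segmentEdges-shift (suc a) L k = segmentEdges-shift a L k

segmentEdges-++ : ∀ A L k → segmentEdges (A ++ L) (sum A + k) ≡ segmentEdges L k
segmentEdges-++ []      L k = refl
segmentEdges-++ (a ∷ A) L k = begin
  segmentEdges (a ∷ A ++ L) (a + sum A + k)   ≡⟨ cong (segmentEdges (a ∷ A ++ L)) (+-assoc a (sum A) k) ⟩
  segmentEdges (a ∷ A ++ L) (a + (sum A + k)) ≡⟨ segmentEdges-shift a (A ++ L) (sum A + k) ⟩
  segmentEdges (A ++ L) (sum A + k)           ≡⟨ segmentEdges-++ A L k ⟩
  segmentEdges L k                            ∎
  where open ≡-Reasoning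

segmentEdges-inside : ∀ A x B q → suc q < x → segmentEdges (A ++ x ∷ B) (sum A + q) ≡ true
segmentEdges-inside A x B q 1+q<x = trans (segmentEdges-++ A (x ∷ B) q) (first x q 1+q<x)
  where
  first : ∀ x q → suc q < x → segmentEdges (x ∷ B) q ≡ true
  first (suc (suc s)) zero    _           = refl
  first (suc s)       (suc q) (s≤s 1+q<s) = first s q 1+q<s

segmentEdges-boundary : ∀ A C k → suc k ≡ sum A → segmentEdges (A ++ C) k ≡ false
segmentEdges-boundary (zero ∷ A)     C k       1+k≡A = segmentEdges-boundary A C k 1+k≡A
segmentEdges-boundary (suc zero ∷ A) C zero    _     = refl
segmentEdges-boundary (suc s ∷ A)    C (suc k) 1+k≡A = segmentEdges-boundary (s ∷ A) C k (suc-injective 1+k≡A)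

record Located (L : List ℕ) (k : ℕ) (R : ℕ → ℕ → Set) : Set where
  constructor located
  field
    A B    : List ℕ
    x q    : ℕ
    L≡     : L ≡ A ++ x ∷ B
    k≡     : k ≡ sum A + q
    inside : R q x

located-zero : ∀ {L k R} → Located L k R → Located (0 ∷ L) k R
located-zero (located A B x q L≡ k≡ r) = located (0 ∷ A) B x q (cong (0 ∷_) L≡) k≡ r

located-suc : ∀ {s L k} {R : ℕ → ℕ → Set} → (∀ {q} → R q s → R (suc q) (suc s)) →
  Located (s ∷ L) k R → Located (suc s ∷ L) (suc k) R
located-suc step (located []      B x q refl refl r) = located [] B (suc x) (suc q) refl refl (step r)
located-suc step (located (a ∷ A) B x q refl refl r) = located (suc a ∷ A) B x q refl refl r

locateVertex : ∀ L k → k < sum L → Located L k _<_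
locateVertex (zero ∷ L)  k       k<L       = located-zero (locateVertex L k k<L)
locateVertex (suc s ∷ L) zero    _         = located [] L (suc s) 0 refl refl (s≤s z≤n)
locateVertex (suc s ∷ L) (suc k) (s≤s k<L) = located-suc s≤s (locateVertex (s ∷ L) k k<L)

locateEdge : ∀ L k → segmentEdges L k ≡ true → Located L k (λ q x → suc q < x)
locateEdge (zero ∷ L)        k       edge = located-zero (locateEdge L k edge)
locateEdge (suc (suc s) ∷ L) zero    _    = located [] L (suc (suc s)) 0 refl refl (s≤s (s≤s z≤n))
locateEdge (suc s ∷ L)       (suc k) edge = located-suc s≤s (locateEdge (s ∷ L) k edge)

deleteVertex-segments : ∀ A x B q → q < x →
  deleteVertex (sum A + q) (segmentEdges (A ++ x ∷ B)) ≗ segmentEdges (A ++ pieces x q ++ B)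
deleteVertex-segments []      x B q q<x = first x q q<x
  where
  first : ∀ x q → q < x → deleteVertex q (segmentEdges (x ∷ B)) ≗ segmentEdges (pieces x q ++ B)
  first (suc s)       zero          _         k       = refl
  first (suc zero)    (suc q)       (s≤s ())
  first (suc (suc s)) (suc zero)    _         zero    = refl
  first (suc (suc s)) (suc (suc q)) _         zero    = refl
  first (suc s)       (suc q)       (s≤s q<s) (suc k) = first s q q<s k
deleteVertex-segments (a ∷ A) x B q q<x k rewrite +-assoc a (sum A) q =
  shift a (deleteVertex-segments A x B q q<x) k
  where
  shift : ∀ a {v R R′} → deleteVertex v (segmentEdges R) ≗ segmentEdges R′ →
    deleteVertex (a + v) (segmentEdges (a ∷ R)) ≗ segmentEdges (a ∷ R′)
  shift zero          eq k       = eq k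
  shift (suc zero)    eq zero    = ∧-zeroʳ _
  shift (suc (suc a)) eq zero    = refl
  shift (suc a)       eq (suc k) = shift a eq k

deleteEdge-segments : ∀ A x B q → suc q < x →
  deleteEdge (sum A + q) (segmentEdges (A ++ x ∷ B)) ≗ segmentEdges (A ++ suc q ∷ (x ∸ suc q) ∷ B)
deleteEdge-segments []      x B q 1+q<x = first x q 1+q<x
  where
  first : ∀ x q → suc q < x → deleteEdge q (segmentEdges (x ∷ B)) ≗ segmentEdges (suc q ∷ (x ∸ suc q) ∷ B)
  first (suc s)       zero    _           zero    = refl
  first (suc s)       zero    _           (suc k) = refl
  first (suc (suc s)) (suc q) _           zero    = refl
  first (suc s)       (suc q) (s≤s 1+q<s) (suc k) = first s q 1+q<s k
deleteEdge-segments (a ∷ A) x B q 1+q<x k rewrite +-assoc a (sum A) q =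
  shift a (deleteEdge-segments A x B q 1+q<x) k
  where
  shift : ∀ a {i R R′} → deleteEdge i (segmentEdges R) ≗ segmentEdges R′ →
    deleteEdge (a + i) (segmentEdges (a ∷ R)) ≗ segmentEdges (a ∷ R′)
  shift zero          eq k       = eq k
  shift (suc zero)    eq zero    = refl
  shift (suc (suc a)) eq zero    = refl
  shift (suc a)       eq (suc k) = shift a eq k

n>0∧n≢1⇒n>1 : ∀ {n} → 0 < n → n ≢ 1 → 1 < n
n>0∧n≢1⇒n>1 {suc zero}    _ n≢1 = ⊥-elim (n≢1 refl)
n>0∧n≢1⇒n>1 {suc (suc n)} _ _   = s≤s (s≤s z≤n)

neighbour : ∀ {n} e (a : Fin n) b → b < n → adjacent e (toℕ a) b ≡ true → Σ[ w ∈ Fin n ] linear n e a w ≡ true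
neighbour e a b b<n adj = fromℕ< b<n , subst (λ c → adjacent e (toℕ a) c ≡ true) (sym (toℕ-fromℕ< b<n)) adj

isolated-linear : ∀ e a → e a ≡ false → (∀ w → suc w ≡ a → e w ≡ false) → ∀ w → adjacent e a w ≡ false
isolated-linear e a ea no-left w rewrite ea | ∧-zeroʳ (suc a ≡ᵇ w) with suc w ≡ᵇ a in 1+w≡ᵇa
... | false = refl
... | true  rewrite no-left w (≡ᵇ⇒≡ _ _ (subst T (sym 1+w≡ᵇa) _)) = refl

-- The first vertex of a segment is joined to its successor, every other vertex to its predecessor.
segment-neighbour : ∀ A x B q → q < x → x ≢ 1 →
  Σ[ b ∈ ℕ ] b < sum (A ++ x ∷ B) × adjacent (segmentEdges (A ++ x ∷ B)) (sum A + q) b ≡ true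
segment-neighbour A x B zero 0<x x≢1 =
  sum A + 1 , sum-middle-< A B 1<x ,
  subst (λ k → adjacent e (sum A + 0) k ≡ true) (sym (+-suc (sum A) 0))
    (adjacent-suc e _ (segmentEdges-inside A x B 0 1<x))
  where
  e = segmentEdges (A ++ x ∷ B)
  1<x : 1 < x
  1<x = n>0∧n≢1⇒n>1 0<x x≢1
segment-neighbour A x B (suc q) 1+q<x x≢1 =
  sum A + q , sum-middle-< A B (<-trans (n<1+n q) 1+q<x) ,
  subst (λ k → adjacent e k (sum A + q) ≡ true) (sym (+-suc (sum A) q))
    (adjacent-pred e _ (segmentEdges-inside A x B q 1+q<x))
  where e = segmentEdges (A ++ x ∷ B)

noSingleton⇒noIsolated : ∀ {n} L → sum L ≡ n → NoSingleton L → NoIsolated (paths n L)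
noSingleton⇒noIsolated L refl noSingleton a with locateVertex L (toℕ a) (toℕ<n a)
... | located A B x q refl a≡ q<x with segment-neighbour A x B q q<x (noSingleton-middle A B noSingleton)
...   | b , b<n , adj = neighbour e a b b<n (subst (λ k → adjacent e k b ≡ true) (sym a≡) adj)
  where e = segmentEdges (A ++ x ∷ B)

singleton-isolated : ∀ {n} A B → sum (A ++ 1 ∷ B) ≡ n → ¬ NoIsolated (paths n (A ++ 1 ∷ B))
singleton-isolated A B refl noIso =
  let w , adj = noIso v in case trans (sym (no-neighbour (toℕ w))) adj of λ ()
  where
  e = segmentEdges (A ++ 1 ∷ B)
  v<n : sum A + 0 < sum (A ++ 1 ∷ B)
  v<n = sum-middle-< A B (s≤s z≤n)
  v = fromℕ< v<n
  no-neighbour : ∀ b → adjacent e (toℕ v) b ≡ false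
  no-neighbour rewrite toℕ-fromℕ< v<n =
    isolated-linear e (sum A + 0) (segmentEdges-++ A (1 ∷ B) 0)
      (λ w 1+w≡ → segmentEdges-boundary A (1 ∷ B) w (trans 1+w≡ (+-identityʳ (sum A))))

noIsolated⇒noSingleton : ∀ {n} L → sum L ≡ n → NoIsolated (paths n L) → NoSingleton L
noIsolated⇒noSingleton L ΣL noIso = tabulate not-singleton
  where
  not-singleton : ∀ {x} → x ∈ L → x ≢ 1
  not-singleton x∈L refl with ∈-∃++ x∈L
  ... | A , B , refl = singleton-isolated A B ΣL noIso

sum-split : ∀ A B {p q} → sum (A ++ p ∷ q ∷ B) ≡ sum (A ++ p + q ∷ B)
sum-split A B {p} {q} = sum-replace A B (sym (+-assoc p q 0))

sum-pieces : ∀ A B {y q} → q < y → suc (sum (A ++ pieces y q ++ B)) ≡ sum (A ++ y ∷ B)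
sum-pieces A B {y} {q} q<y = begin
  suc (sum (A ++ pieces y q ++ B))           ≡⟨ cong suc (sum-replace A B (sym (+-assoc q (y ∸ suc q) 0))) ⟩
  suc (sum (A ++ q + (y ∸ suc q) ∷ B))       ≡⟨ cong suc (sum-++ A _) ⟩
  suc (sum A + (q + (y ∸ suc q) + sum B))    ≡⟨ sym (+-suc (sum A) _) ⟩
  sum A + (suc q + (y ∸ suc q) + sum B)      ≡⟨ cong (λ z → sum A + (z + sum B)) (m+[n∸m]≡n q<y) ⟩
  sum A + (y + sum B)                        ≡⟨ sym (sum-++ A (y ∷ B)) ⟩
  sum (A ++ y ∷ B)                           ∎
  where open ≡-Reasoning

deleteVertex-paths : ∀ {m} A y B q (v : Fin (suc m)) → toℕ v ≡ sum A + q → q < y →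
  delV (paths (suc m) (A ++ y ∷ B)) v ≈ᴳ paths m (A ++ pieces y q ++ B)
deleteVertex-paths {m} A y B q v v≡ q<y = ≈ᴳ-trans (delV-linear m e v)
  (linear-cong m λ k → trans (cong (λ c → deleteVertex c e k) v≡) (deleteVertex-segments A y B q q<y k))
  where e = segmentEdges (A ++ y ∷ B)

deleteEdge-paths : ∀ {n} A x B q (i j : Fin n) → toℕ i ≡ sum A + q → toℕ j ≡ suc (toℕ i) → suc q < x →
  delE (paths n (A ++ x ∷ B)) i j ≈ᴳ paths n (A ++ suc q ∷ (x ∸ suc q) ∷ B)
deleteEdge-paths {n} A x B q i j i≡ j≡1+i 1+q<x = ≈ᴳ-trans (delE-linear n e i j j≡1+i)
  (linear-cong n λ k → trans (cong (λ c → deleteEdge c e k) i≡) (deleteEdge-segments A x B q 1+q<x k))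
  where e = segmentEdges (A ++ x ∷ B)

leftMove-paths : ∀ {m} A y B q → sum (A ++ y ∷ B) ≡ suc m → q < y →
  Σ[ v ∈ Fin (suc m) ] delV (paths (suc m) (A ++ y ∷ B)) v ≈ᴳ paths m (A ++ pieces y q ++ B)
leftMove-paths A y B q ΣL q<y = v , deleteVertex-paths A y B q v (toℕ-fromℕ< v<n) q<y
  where
  v<n = subst (sum A + q <_) ΣL (sum-middle-< A B q<y)
  v = fromℕ< v<n

-- Deleting the edge between the second and third vertex of a segment with at least 4 vertices is legal.
hasLegalR-paths : ∀ {n} L → sum L ≡ n → NoSingleton L → Any (4 ≤_) L → HasLegalR (paths n L)
hasLegalR-paths L ΣL noSingleton long with find long
... | z , z∈L , 4≤z with ∈-∃++ z∈L
...   | C , D , refl = i , j , i<j , edge , noIsolated-resp (≈ᴳ-sym del≈) noIso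
  where
  2<z = ≤-trans (s≤s (s≤s (s≤s z≤n))) 4≤z
  i<n = subst (sum C + 1 <_) ΣL (sum-middle-< C D (<-trans (s≤s (s≤s z≤n)) 2<z))
  j<n = subst (sum C + 2 <_) ΣL (sum-middle-< C D 2<z)
  i = fromℕ< i<n
  j = fromℕ< j<n
  j≡1+i : toℕ j ≡ suc (toℕ i)
  j≡1+i = trans (toℕ-fromℕ< j<n) (trans (+-suc (sum C) 1) (cong suc (sym (toℕ-fromℕ< i<n))))
  i<j : toℕ i < toℕ j
  i<j = subst (toℕ i <_) (sym j≡1+i) (n<1+n (toℕ i))
  edge : adjacent (segmentEdges (C ++ z ∷ D)) (toℕ i) (toℕ j) ≡ true
  edge rewrite j≡1+i | toℕ-fromℕ< i<n =
    adjacent-suc (segmentEdges (C ++ z ∷ D)) _ (segmentEdges-inside C z D 1 2<z)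
  del≈ = deleteEdge-paths C z D 1 i j (toℕ-fromℕ< i<n) j≡1+i 2<z
  ∸2≢1 : ∀ {x} → 4 ≤ x → x ∸ 2 ≢ 1
  ∸2≢1 (s≤s (s≤s (s≤s (s≤s _)))) ()
  ΣL′ = trans (sum-split C D) (trans (cong (λ x → sum (C ++ x ∷ D)) (m+[n∸m]≡n (<⇒≤ 2<z))) ΣL)
  noIso = noSingleton⇒noIsolated _ ΣL′ (noSingleton-replace C D noSingleton ((λ ()) ∷ ∸2≢1 4≤z ∷ []))

data Split : List ℕ → List ℕ → Set where
  split : ∀ A B {p q} → 2 ≤ p → 2 ≤ q → Split (A ++ p + q ∷ B) (A ++ p ∷ q ∷ B)

split-sum : ∀ {L L′} → Split L L′ → sum L′ ≡ sum L
split-sum (split A B _ _) = sum-split A B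

rightMove-paths : ∀ {n} L {i j : Fin n} → sum L ≡ n → LegalR (paths n L) i j →
  Σ[ L′ ∈ List ℕ ] Split L L′ × NoSingleton L′ × delE (paths n L) i j ≈ᴳ paths n L′
rightMove-paths L {i} {j} ΣL (i<j , edge , noIso) with adjacent-forward (segmentEdges L) _ _ i<j edge
... | j≡1+i , present with locateEdge L (toℕ i) present
...   | located A B x q refl i≡ 1+q<x = L′ , subst (λ z → Split (A ++ z ∷ B) L′) x≡ splitL , noSingletonL′ , del≈
  where
  L′ = A ++ suc q ∷ (x ∸ suc q) ∷ B
  x≡ : suc q + (x ∸ suc q) ≡ x
  x≡ = m+[n∸m]≡n (<⇒≤ 1+q<x)
  del≈ = deleteEdge-paths A x B q i j i≡ j≡1+i 1+q<x
  noSingletonL′ : NoSingleton L′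
  noSingletonL′ = noIsolated⇒noSingleton L′ (trans (sum-split A B) (trans (cong (λ z → sum (A ++ z ∷ B)) x≡) ΣL))
                    (noIsolated-resp del≈ noIso)
  splitL : Split (A ++ suc q + (x ∸ suc q) ∷ B) L′
  splitL with ++⁻ʳ A noSingletonL′
  ... | p≢1 ∷ r≢1 ∷ _ = split A B (n>0∧n≢1⇒n>1 (s≤s z≤n) p≢1) (n>0∧n≢1⇒n>1 (m<n⇒0<n∸m 1+q<x) r≢1)

-- Summaries of segment lists

record Summary : Set where
  constructor summary
  field
    odd4 odd568 has5 has6 has8 : Bool
open Summary

infixr 5 _⊕_
infixr 1 _⇒_

_⊕_ : Summary → Summary → Summary
summary a b c d e ⊕ summary a′ b′ c′ d′ e′ = summary (a xor a′) (b xor b′) (c ∨ c′) (d ∨ d′) (e ∨ e′)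

ε : Summary
ε = summary false false false false false

⊕-assoc : ∀ s t u → (s ⊕ t) ⊕ u ≡ s ⊕ (t ⊕ u)
⊕-assoc (summary a b c d e) (summary a′ b′ c′ d′ e′) (summary a″ b″ c″ d″ e″)
  rewrite xor-assoc a a′ a″ | xor-assoc b b′ b″ | ∨-assoc c c′ c″ | ∨-assoc d d′ d″ | ∨-assoc e e′ e″ = refl

⊕-comm : ∀ s t → s ⊕ t ≡ t ⊕ s
⊕-comm (summary a b c d e) (summary a′ b′ c′ d′ e′)
  rewrite xor-comm a a′ | xor-comm b b′ | ∨-comm c c′ | ∨-comm d d′ | ∨-comm e e′ = refl

single : ℕ → Summary
single x = summary (x ≡ᵇ 4) ((x ≡ᵇ 5) ∨ (x ≡ᵇ 6) ∨ (x ≡ᵇ 8)) (x ≡ᵇ 5) (x ≡ᵇ 6) (x ≡ᵇ 8)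

single-long : ∀ {x} → 9 ≤ x → single x ≡ ε
single-long 9≤x with m≤n⇒∃[o]m+o≡n 9≤x
... | _ , refl = refl

summarize : List ℕ → Summary
summarize []      = ε
summarize (x ∷ L) = single x ⊕ summarize L

summarize-++ : ∀ A B → summarize (A ++ B) ≡ summarize A ⊕ summarize B
summarize-++ []      B = refl
summarize-++ (a ∷ A) B = trans (cong (single a ⊕_) (summarize-++ A B)) (sym (⊕-assoc (single a) _ _))

summarize-middle : ∀ C M D → summarize (C ++ M ++ D) ≡ summarize M ⊕ summarize (C ++ D)
summarize-middle C M D = begin
  summarize (C ++ M ++ D)   ≡⟨ trans (summarize-++ C (M ++ D)) (cong (sC ⊕_) (summarize-++ M D)) ⟩
  sC ⊕ (sM ⊕ sD)            ≡⟨ sym (⊕-assoc sC sM sD) ⟩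
  (sC ⊕ sM) ⊕ sD            ≡⟨ cong (_⊕ sD) (⊕-comm sC sM) ⟩
  (sM ⊕ sC) ⊕ sD            ≡⟨ ⊕-assoc sM sC sD ⟩
  sM ⊕ (sC ⊕ sD)            ≡⟨ cong (sM ⊕_) (sym (summarize-++ C D)) ⟩
  sM ⊕ summarize (C ++ D)   ∎
  where
  open ≡-Reasoning
  sC = summarize C
  sM = summarize M
  sD = summarize D

summarize-replace : ∀ C D {M M′} → summarize M ≡ summarize M′ → summarize (C ++ M ++ D) ≡ summarize (C ++ M′ ++ D)
summarize-replace C D {M} {M′} eq =
  trans (summarize-middle C M D) (trans (cong (_⊕ summarize (C ++ D)) eq) (sym (summarize-middle C M′ D)))

_⇒_ : Bool → Bool → Bool
a ⇒ b = not a ∨ b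

⇒-sound : ∀ {a b} → T (a ⇒ b) → T a → T b
⇒-sound {true} h _ = h

⇒-refl : ∀ b → T (b ⇒ b)
⇒-refl true  = _
⇒-refl false = _

∧-intro : ∀ {a b} → T a → T b → T (a ∧ b)
∧-intro ta tb = Equivalence.from T-∧ (ta , tb)

∨-introˡ : ∀ {a b} → T a → T (a ∨ b)
∨-introˡ ta = Equivalence.from T-∨ (inj₁ ta)

∨-introʳ : ∀ {a b} → T b → T (a ∨ b)
∨-introʳ tb = Equivalence.from T-∨ (inj₂ tb)

-- Every summary of a list is consistent; the exhaustive checks below only range over consistent summaries.
consistent : Summary → Bool
consistent t = odd568 t ⇒ has5 t ∨ has6 t ∨ has8 t

winning : Summary → Bool
winning t = not (odd4 t xor odd568 t) ∧ (odd4 t ⇒ has5 t ∨ has8 t)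

-- The invariant of Left's strategy, for positions with Right to move.
Winning : List ℕ → Set
Winning L = T (winning (summarize L))

allBool : (Bool → Bool) → Bool
allBool f = f true ∧ f false

allBool-sound : ∀ f → T (allBool f) → ∀ b → T (f b)
allBool-sound f h true  = proj₁ (Equivalence.to T-∧ h)
allBool-sound f h false = proj₂ (Equivalence.to T-∧ h)

allSummaries : (Summary → Bool) → Bool
allSummaries f = allBool λ a → allBool λ b → allBool λ c → allBool λ d → allBool λ e → f (summary a b c d e)

allSummaries-sound : ∀ f → T (allSummaries f) → ∀ t → T (f t)
allSummaries-sound f h (summary a b c d e) =
  allBool-sound (λ e → f (summary a b c d e))
  (allBool-sound (λ d → allBool λ e → f (summary a b c d e))
  (allBool-sound (λ c → allBool λ d → allBool λ e → f (summary a b c d e))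
  (allBool-sound (λ b → allBool λ c → allBool λ d → allBool λ e → f (summary a b c d e))
  (allBool-sound (λ a → allBool λ b → allBool λ c → allBool λ d → allBool λ e → f (summary a b c d e)) h a) b) c) d) e

consistent-⊕ : ∀ s t → T (consistent s) → T (consistent t) → T (consistent (s ⊕ t))
consistent-⊕ s t =
  ⇒-sound ∘ ⇒-sound (allSummaries-sound (closed s) (allSummaries-sound (allSummaries ∘ closed) _ s) t)
  where
  closed : Summary → Summary → Bool
  closed s t = consistent s ⇒ consistent t ⇒ consistent (s ⊕ t)

consistent-summarize : ∀ L → T (consistent (summarize L))
consistent-summarize []      = _
consistent-summarize (x ∷ L) =
  consistent-⊕ (single x) (summarize L) (⇒-refl ((x ≡ᵇ 5) ∨ (x ≡ᵇ 6) ∨ (x ≡ᵇ 8))) (consistent-summarize L)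

-- Left's replies

data KeyLength : Set where
  four five six eight : KeyLength

value : KeyLength → ℕ
value four  = 4
value five  = 5
value six   = 6
value eight = 8

-- A bit of the summary that guarantees a segment of the given length (an odd number of 4s guarantees a 4).
present : KeyLength → Summary → Bool
present four  = odd4
present five  = has5
present six   = has6
present eight = has8

present-⊕ : ∀ κ x s → T (present κ (single x ⊕ s)) → x ≡ value κ ⊎ T (present κ s)
present-⊕ four  x s h with x ≡ᵇ 4 in x≡ᵇ4
... | true  = inj₁ (≡ᵇ⇒≡ x 4 (subst T (sym x≡ᵇ4) _))
... | false = inj₂ h
present-⊕ five  x s h = map₁ (≡ᵇ⇒≡ x 5) (Equivalence.to T-∨ h)
present-⊕ six   x s h = map₁ (≡ᵇ⇒≡ x 6) (Equivalence.to T-∨ h)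
present-⊕ eight x s h = map₁ (≡ᵇ⇒≡ x 8) (Equivalence.to T-∨ h)

present-∈ : ∀ κ L → T (present κ (summarize L)) → value κ ∈ L
present-∈ four  [] ()
present-∈ five  [] ()
present-∈ six   [] ()
present-∈ eight [] ()
present-∈ κ (x ∷ L) h with present-⊕ κ x (summarize L) h
... | inj₁ refl = here refl
... | inj₂ h′   = there (present-∈ κ L h′)

data Reply : Set where
  cut     : KeyLength → ℕ → Reply
  neutral : Reply

-- `cut κ q` deletes vertex q of a segment of length `value κ`: the first four replies turn a 4, 8, 6, 5 into
-- 3, 7, 2+3, 2+2 and repair the parity condition of `winning`; the next three turn an 8, 6, 5 into 2+5, 5, 4.
reply : Summary → Reply
reply t =
  if odd4 t xor odd568 t
  then (if odd4 t then cut four 0 else if has8 t then cut eight 0 else if has6 t then cut six 2 else cut five 2)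
  else (if has8 t then cut eight 2 else if has6 t then cut six 0 else if has5 t then cut five 0 else neutral)

isCut : KeyLength → ℕ → Reply → Bool
isCut κ q (cut κ′ q′) = (value κ ≡ᵇ value κ′) ∧ (q ≡ᵇ q′)
isCut κ q neutral     = false

isNeutral : Reply → Bool
isNeutral (cut _ _) = false
isNeutral neutral   = true

validCut : ℕ → ℕ → Bool
validCut y q = (q <ᵇ y) ∧ (4 ≤ᵇ y) ∧ not (q ≡ᵇ 1) ∧ not (y ∸ suc q ≡ᵇ 1)

-- The summary r stands for the segments other than the one that is cut.
cutRestoresWinning : KeyLength → ℕ → Summary → Bool
cutRestoresWinning κ q r =
  consistent r ∧ isCut κ q (reply (summarize [ value κ ] ⊕ r)) ⇒ winning (summarize (pieces (value κ) q) ⊕ r)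

replyCorrect : Summary → Reply → Bool
replyCorrect t (cut κ q) = present κ t ∧ validCut (value κ) q ∧ allSummaries (cutRestoresWinning κ q)
replyCorrect t neutral   = winning t

reply-correct : ∀ t → T (consistent t) → T (replyCorrect t (reply t))
reply-correct = ⇒-sound ∘ allSummaries-sound (λ t → consistent t ⇒ replyCorrect t (reply t)) _

-- Segments of these lengths can be cut without changing the summary, and without isolating a vertex.
hasNeutralCut : ℕ → Bool
hasNeutralCut x = (x ≡ᵇ 3) ∨ (x ≡ᵇ 7) ∨ (9 ≤ᵇ x)

record NeutralCut (g : ℕ) : Set where
  constructor neutralCut
  field
    q           : ℕ
    q<g         : q < g
    noSingleton : NoSingleton (pieces g q)
    same        : summarize (pieces g q) ≡ summarize [ g ]

neutral-cut : ∀ g → T (hasNeutralCut g) → NeutralCut g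
neutral-cut 3 _ = neutralCut 0 (s≤s z≤n) ((λ ()) ∷ (λ ()) ∷ []) refl
neutral-cut 7 _ = neutralCut 3 (s≤s (s≤s (s≤s (s≤s z≤n)))) ((λ ()) ∷ (λ ()) ∷ []) refl
neutral-cut 9 _ = neutralCut 4 (s≤s (s≤s (s≤s (s≤s (s≤s z≤n))))) ((λ ()) ∷ (λ ()) ∷ []) refl
neutral-cut (suc (suc (suc (suc (suc (suc (suc (suc (suc (suc _)))))))))) _ =
  neutralCut 0 (s≤s z≤n) ((λ ()) ∷ (λ ()) ∷ []) refl

allBelow : ℕ → (ℕ → Bool) → Bool
allBelow zero    f = true
allBelow (suc n) f = f n ∧ allBelow n f

allBelow-sound : ∀ n f → T (allBelow n f) → ∀ m → m < n → T (f m)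
allBelow-sound (suc n) f h m m<1+n with m<1+n⇒m<n∨m≡n m<1+n
... | inj₁ m<n  = allBelow-sound n f (proj₂ (Equivalence.to T-∧ h)) m m<n
... | inj₂ refl = proj₁ (Equivalence.to T-∧ h)

neutralCutAvailable : ℕ → ℕ → Bool
neutralCutAvailable p q = (hasNeutralCut p ∨ hasNeutralCut q) ∧ ((4 ≤ᵇ p) ∨ (4 ≤ᵇ q))

9≤⇒4≤ : ∀ {x} → 9 ≤ x → 4 ≤ x
9≤⇒4≤ = ≤-trans (s≤s (s≤s (s≤s (s≤s z≤n))))

long-hasNeutralCut : ∀ {x} → 9 ≤ x → T (hasNeutralCut x)
long-hasNeutralCut {x} 9≤x = ∨-introʳ {x ≡ᵇ 3} (∨-introʳ {x ≡ᵇ 7} (≤⇒≤ᵇ 9≤x))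

neutralCutAvailableˡ : ∀ {p} q → 9 ≤ p → T (neutralCutAvailable p q)
neutralCutAvailableˡ {p} q 9≤p = ∧-intro {hasNeutralCut p ∨ hasNeutralCut q} {(4 ≤ᵇ p) ∨ (4 ≤ᵇ q)}
  (∨-introˡ (long-hasNeutralCut 9≤p)) (∨-introˡ {4 ≤ᵇ p} (≤⇒≤ᵇ (9≤⇒4≤ 9≤p)))

neutralCutAvailableʳ : ∀ p {q} → 9 ≤ q → T (neutralCutAvailable p q)
neutralCutAvailableʳ p {q} 9≤q = ∧-intro {hasNeutralCut p ∨ hasNeutralCut q} {(4 ≤ᵇ p) ∨ (4 ≤ᵇ q)}
  (∨-introʳ {hasNeutralCut p} (long-hasNeutralCut 9≤q)) (∨-introʳ {4 ≤ᵇ p} (≤⇒≤ᵇ (9≤⇒4≤ 9≤q)))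

-- Checked by exhaustion for p, q < 9; a piece with at least 9 vertices always has a neutral cut.
neutral-after-split : ∀ p q r → 2 ≤ p → 2 ≤ q → T (consistent r) → T (winning (summarize [ p + q ] ⊕ r)) →
  reply (summarize (p ∷ q ∷ []) ⊕ r) ≡ neutral → T (neutralCutAvailable p q)
neutral-after-split p q r 2≤p 2≤q cr win eq with 9 ≤? p | 9 ≤? q
... | yes 9≤p | _       = neutralCutAvailableˡ q 9≤p
... | no _    | yes 9≤q = neutralCutAvailableʳ p 9≤q
... | no 9≰p  | no 9≰q  =
  ⇒-sound (allSummaries-sound (check p q)
    (⇒-sound (allBelow-sound 9 (row p) (allBelow-sound 9 (λ p → allBelow 9 (row p)) _ p (≰⇒> 9≰p)) q (≰⇒> 9≰q))
      (∧-intro (≤⇒≤ᵇ 2≤p) (≤⇒≤ᵇ 2≤q))) r)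
    (∧-intro cr (∧-intro win (subst (T ∘ isNeutral) (sym eq) _)))
  where
  check : ℕ → ℕ → Summary → Bool
  check p q r = consistent r ∧ winning (summarize [ p + q ] ⊕ r) ∧ isNeutral (reply (summarize (p ∷ q ∷ []) ⊕ r))
                ⇒ neutralCutAvailable p q
  row : ℕ → ℕ → Bool
  row p q = (2 ≤ᵇ p) ∧ (2 ≤ᵇ q) ⇒ allSummaries (check p q)

record LeftReply (L : List ℕ) : Set where
  constructor leftReply
  field
    C D          : List ℕ
    y q          : ℕ
    L≡           : L ≡ C ++ y ∷ D
    q<y          : q < y
    noSingleton  : NoSingleton (pieces y q)
    afterwards   : Winning (C ++ pieces y q ++ D)
    rightCanMove : Any (4 ≤_) L

validCut-sound : ∀ y q → T (validCut y q) → q < y × 4 ≤ y × NoSingleton (pieces y q)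
validCut-sound y q valid with Equivalence.to T-∧ valid
... | q<ᵇy , rest with Equivalence.to T-∧ rest
...   | 4≤ᵇy , rest′ with Equivalence.to T-∧ rest′
...     | q≢ᵇ1 , r≢ᵇ1 = <ᵇ⇒< q y q<ᵇy , ≤ᵇ⇒≤ 4 y 4≤ᵇy , ≢ᵇ1 q≢ᵇ1 ∷ ≢ᵇ1 r≢ᵇ1 ∷ []
  where
  ≢ᵇ1 : ∀ {x} → T (not (x ≡ᵇ 1)) → x ≢ 1
  ≢ᵇ1 h refl = h

cut-reply : ∀ L κ q → reply (summarize L) ≡ cut κ q → T (replyCorrect (summarize L) (cut κ q)) → LeftReply L
cut-reply L κ q replied correct with Equivalence.to T-∧ correct
... | present , rest with Equivalence.to T-∧ rest | ∈-∃++ (present-∈ κ L present)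
...   | valid , preserves | C , D , refl with validCut-sound (value κ) q valid
...     | q<y , 4≤y , noSingleton =
  leftReply C D (value κ) q refl q<y noSingleton afterwards (++⁺ʳ C (here 4≤y))
  where
  y = value κ
  r = summarize (C ++ D)
  replied′ : reply (summarize [ y ] ⊕ r) ≡ cut κ q
  replied′ = trans (cong reply (sym (summarize-middle C [ y ] D))) replied
  afterwards : Winning (C ++ pieces y q ++ D)
  afterwards = subst (T ∘ winning) (sym (summarize-middle C (pieces y q) D))
    (⇒-sound (allSummaries-sound (cutRestoresWinning κ q) preserves r)
      (∧-intro (consistent-summarize (C ++ D))
        (subst (T ∘ isCut κ q) (sym replied′) (∧-intro (≡⇒≡ᵇ y y refl) (≡⇒≡ᵇ q q refl)))))

neutral-reply : ∀ {L} C g D → L ≡ C ++ g ∷ D → T (hasNeutralCut g) → Winning L → Any (4 ≤_) L → LeftReply L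
neutral-reply C g D refl hasCut win long with neutral-cut g hasCut
... | neutralCut q q<g noSingleton same =
  leftReply C D g q refl q<g noSingleton (subst (T ∘ winning) (sym (summarize-replace C D same)) win) long

neutral-split-reply : ∀ A B {p q} → 2 ≤ p → 2 ≤ q → Winning (A ++ p + q ∷ B) → Winning (A ++ p ∷ q ∷ B) →
  reply (summarize (A ++ p ∷ q ∷ B)) ≡ neutral → LeftReply (A ++ p ∷ q ∷ B)
neutral-split-reply A B {p} {q} 2≤p 2≤q win win′ replied with Equivalence.to T-∧ available
  where
  available : T (neutralCutAvailable p q)
  available = neutral-after-split p q (summarize (A ++ B)) 2≤p 2≤q (consistent-summarize (A ++ B))
    (subst (T ∘ winning) (summarize-middle A [ p + q ] B) win)
    (trans (cong reply (sym (summarize-middle A (p ∷ q ∷ []) B))) replied)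
... | hasCut , hasLong = choose (Equivalence.to T-∨ hasCut)
  where
  long : Any (4 ≤_) (A ++ p ∷ q ∷ B)
  long with Equivalence.to T-∨ hasLong
  ... | inj₁ 4≤p = ++⁺ʳ A (here (≤ᵇ⇒≤ 4 p 4≤p))
  ... | inj₂ 4≤q = ++⁺ʳ A (there (here (≤ᵇ⇒≤ 4 q 4≤q)))
  choose : T (hasNeutralCut p) ⊎ T (hasNeutralCut q) → LeftReply (A ++ p ∷ q ∷ B)
  choose (inj₁ p-cut) = neutral-reply A p (q ∷ B) refl p-cut win′ long
  choose (inj₂ q-cut) = neutral-reply (A ++ [ p ]) q B (sym (++-assoc A [ p ] (q ∷ B))) q-cut win′ long

left-reply : ∀ {L L′} → Split L L′ → Winning L → LeftReply L′
left-reply {L′ = L′} s win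
  with reply (summarize L′) in replied | reply-correct (summarize L′) (consistent-summarize L′)
left-reply s                    win | cut κ q | correct = cut-reply _ κ q replied correct
left-reply (split A B 2≤p 2≤q) win | neutral | win′    = neutral-split-reply A B 2≤p 2≤q win win′ replied

-- The strategy

leftWinsR-paths : ∀ m L → sum L ≡ m → NoSingleton L → Winning L → LeftWinsR (paths m L)
leftWinsL-paths : ∀ m L → sum L ≡ suc m → NoSingleton L → LeftReply L → LeftWinsL (paths (suc m) L)

leftWinsR-paths zero    L ΣL noSingleton win = respond λ _ ()
leftWinsR-paths (suc m) L ΣL noSingleton win = respond λ _ i j legal →
  let L′ , s , noSingleton′ , del≈ = rightMove-paths L ΣL legal
  in leftWinsL-resp (≈ᴳ-sym del≈)
       (leftWinsL-paths m L′ (trans (split-sum s) ΣL) noSingleton′ (left-reply s win))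

leftWinsL-paths m L ΣL noSingleton (leftReply C D y q refl q<y noSingletonPieces afterwards rightCanMove) =
  move v (noIsolated-resp (≈ᴳ-sym del≈) (noSingleton⇒noIsolated L′ ΣL′ noSingleton′))
    (hasLegalR-paths L ΣL noSingleton rightCanMove)
    (leftWinsR-resp (≈ᴳ-sym del≈) (leftWinsR-paths m L′ ΣL′ noSingleton′ afterwards))
  where
  L′ = C ++ pieces y q ++ D
  ΣL′ : sum L′ ≡ m
  ΣL′ = suc-injective (trans (sum-pieces C D q<y) ΣL)
  noSingleton′ = noSingleton-replace C D noSingleton noSingletonPieces
  moved = leftMove-paths C y D q ΣL q<y
  v = proj₁ moved
  del≈ = proj₂ moved

path-paths : ∀ n → path n ≈ᴳ paths n [ n ]
path-paths n i j = cong₂ _∨_ (edge-in-path (toℕ i) (toℕ j) (toℕ<n j)) (edge-in-path (toℕ j) (toℕ i) (toℕ<n i))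
  where
  edge-in-path : ∀ a b → b < n → (suc a ≡ᵇ b) ≡ ((suc a ≡ᵇ b) ∧ segmentEdges [ n ] a)
  edge-in-path a b b<n with suc a ≡ᵇ b in 1+a≡ᵇb
  ... | false = refl
  ... | true  = sym (segmentEdges-inside [] n [] a (subst (_< n) (sym (≡ᵇ⇒≡ _ _ (subst T (sym 1+a≡ᵇb) _))) b<n))

long-noSingleton : ∀ {n} → 9 ≤ n → NoSingleton [ n ]
long-noSingleton (s≤s (s≤s _)) = (λ ()) ∷ []

long-winning : ∀ {n} → 9 ≤ n → Winning [ n ]
long-winning 9≤n = subst (λ s → T (winning (s ⊕ ε))) (sym (single-long 9≤n)) _

opening-reply : ∀ {n} → 9 ≤ n → LeftReply [ n ]
opening-reply {n} 9≤n = neutral-reply [] n [] refl (long-hasNeutralCut 9≤n) (long-winning 9≤n) (here (9≤⇒4≤ 9≤n))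

theorem3p18 : (n : ℕ) → 9 ≤ n → LeftWinsL (path n) × LeftWinsR (path n)
theorem3p18 n@(suc m) 9≤n =
  leftWinsL-resp path≈ (leftWinsL-paths m [ n ] Σ[n] (long-noSingleton 9≤n) (opening-reply 9≤n)) ,
  leftWinsR-resp path≈ (leftWinsR-paths n [ n ] Σ[n] (long-noSingleton 9≤n) (long-winning 9≤n))
  where
  path≈ = ≈ᴳ-sym (path-paths n)
  Σ[n] = +-identityʳ n
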